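{- Let $k\in\mathbb N$ be a constant, $G=(V,E)$ a graph, and $A,B,C$ pairwise disjoint split-modules of $G$ with $A\cup B\cup C=V$. Let $a\in N(A)$, $b\in N(B)$ and $c\in N(C)$ be arbitrary vertices. If $\max(\mathrm{rw}(G[A\cup\{a\}]),\mathrm{rw}(G[B\cup\{b\}]),\mathrm{rw}(G[C\cup\{c\}]))\le k$, then $\mathrm{rw}(G)\le k$.
   Context: All graphs are finite, simple and undirected; $\mathrm{rw}$ is rank-width. For $A\subseteq V(G)$, $N(A)$ is the set of vertices of $V(G)\setminus A$ with a neighbour in $A$. A split of a connected graph $G=(V,E)$ is a bipartition $\{A,B\}$ of $V$ such that every vertex of $N(B)$ has the same neighbourhood in $N(A)$. A split-module of $G$ is a set $A\subseteq V$ such that for some connected component $G'=(V',E')$ of $G$, $\{A,V'\setminus A\}$ is a split of $G'$; $V$ and $\emptyset$ are also split-modules. -}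

module Defs where

open import Data.Nat using (ℕ; zero; suc)
open import Data.Bool using (Bool; true; false; _∧_; _xor_)
open import Data.Fin using (Fin; zero; suc)
open import Data.Fin.Subset using (Subset; _∈_; _∉_; _⊆_; _─_; ⊤; ⊥; Nonempty)
open import Data.List using (List; []; _∷_; _++_)
import Data.List.Membership.Propositional as LM
open import Data.List.Relation.Unary.Unique.Propositional using (Unique)
open import Data.Product using (Σ; ∃; _×_; _,_)
open import Data.Sum using (_⊎_)
open import Relation.Binary.PropositionalEquality using (_≡_)

record Graph (n : ℕ) : Set where
  field
    adj     : Fin n → Fin n → Bool
    symm    : ∀ u v → adj u v ≡ adj v u
    irrefl  : ∀ v → adj v v ≡ false
open Graph public

module _ {n : ℕ} (G : Graph n) where

  Nbh : Subset n → Fin n → Set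
  Nbh X v = v ∉ X × ∃ λ u → u ∈ X × adj G u v ≡ true

  data Path : Fin n → Fin n → Set where
    here : ∀ {u} → Path u u
    step : ∀ {u v w} → adj G u v ≡ true → Path v w → Path u w

  -- V' is (the vertex set of) a connected component of G:
  -- nonempty, connected, and closed under adjacency (maximality).
  IsComponent : Subset n → Set
  IsComponent V' =
    Nonempty V' ×
    (∀ u v → u ∈ V' → v ∈ V' → Path u v) ×
    (∀ u v → u ∈ V' → adj G u v ≡ true → v ∈ V')

  -- {A , B} is a split of the component with vertex set V' = A ∪ B:
  -- A, B nonempty and every vertex of N(B) has the same neighbourhood in N(A).
  IsSplit : Subset n → Subset n → Set
  IsSplit A B =
    Nonempty A × Nonempty B ×
    (∀ x y z → Nbh B x → Nbh B y → Nbh A z → adj G x z ≡ adj G y z)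

  SplitModule : Subset n → Set
  SplitModule A =
    (A ≡ ⊤) ⊎ (A ≡ ⊥) ⊎
    (∃ λ V' → IsComponent V' × A ⊆ V' × IsSplit A (V' ─ A))

  xsum : (m : ℕ) → (Fin m → Bool) → Bool
  xsum zero    f = false
  xsum (suc m) f = f zero xor xsum m (λ i → f (suc i))

  -- cut-rank in G[S] of X ⊆ S is at most k: the GF(2) matrix
  -- (adj x y) indexed by x ∈ X, y ∈ S ∖ X has rank ≤ k
  -- (i.e. factors as a product of an |X|×k and a k×|S∖X| matrix).
  CutRank≤ : Subset n → (Fin n → Set) → ℕ → Set
  CutRank≤ S X k =
    Σ (Fin n → Fin k → Bool) λ P → Σ (Fin k → Fin n → Bool) λ Q →
      ∀ x y → X x → y ∈ S → ¬X y → adj G x y ≡ xsum k (λ i → P x i ∧ Q i y)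
    where
    open import Relation.Nullary using (¬_)
    ¬X : Fin n → Set
    ¬X y = ¬ X y

data BTree (n : ℕ) : Set where
  leaf : Fin n → BTree n
  node : BTree n → BTree n → BTree n

leaves : ∀ {n} → BTree n → List (Fin n)
leaves (leaf v)   = v ∷ []
leaves (node l r) = leaves l ++ leaves r

AllSub : ∀ {n} → (BTree n → Set) → BTree n → Set
AllSub P (leaf v)   = P (leaf v)
AllSub P (node l r) = P (node l r) × AllSub P l × AllSub P r

module _ {n : ℕ} (G : Graph n) where

  IsDecomp : Subset n → BTree n → Set
  IsDecomp S t = Unique (leaves t) × (∀ v → (v ∈ S → v LM.∈ leaves t) × (v LM.∈ leaves t → v ∈ S))

  RW≤ : Subset n → ℕ → Set
  RW≤ S k =
    (∀ v → v ∉ S) ⊎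
    (∃ λ t → IsDecomp S t × AllSub (λ s → CutRank≤ G S (λ x → x LM.∈ leaves s) k) t)

-- If X is a split-module and x ∈ N(X), the adjacency between X and its
-- complement factors as  adj u y = adj u x ∧ adj w y  for a fixed w ∈ X, so
-- seen from X the single vertex x stands in for the whole complement: a cut
-- L ⊆ X of G[X ∪ {x}] has the same cut-rank in G. Rerooting a
-- rank-decomposition of G[X ∪ {x}] at the leaf x (cut-rank is invariant under
-- complementation) thus gives a decomposition of X all of whose cuts have
-- rank ≤ k in G. Hanging the decompositions of A, B and C below a common root
-- gives one of G: the only new cut, B ∪ C, is the complement of A.
module Submission where

open import Defs
open import Data.Bool using (Bool; true; false; _∧_; _xor_)
open import Data.Vec using (_∷_; here; there)
open import Data.Bool.Properties using (∧-comm; ∧-assoc; ∧-distribʳ-xor)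
open import Data.Fin using (Fin; zero; suc)
open import Data.Fin.Subset using (Subset; _∈_; _∉_; _─_; _∪_; _∩_; ⁅_⁆; ⊤; Empty)
open import Data.Fin.Subset.Properties
  using (_∈?_; ∈⊤; ∉⊥; x∈⁅x⁆; x∈⁅y⁆⇒x≡y; x∈p∪q⁺; x∈p∪q⁻; x∈p∩q⁺; x∈p∩q⁻; x∈p∧x∉q⇒x∈p─q)
open import Data.List using (List; _∷_; _++_)
open import Data.List.Properties using (++-assoc)
open import Data.List.Membership.Propositional using () renaming (_∈_ to _∈L_)
open import Data.List.Membership.Propositional.Properties using (∈-++⁺ˡ; ∈-++⁺ʳ; ∈-++⁻)
open import Data.List.Relation.Binary.Disjoint.Propositional using (Disjoint)
open import Data.List.Relation.Binary.Subset.Propositional using () renaming (_⊆_ to _⊆L_)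
open import Data.List.Relation.Binary.Permutation.Propositional
  using (_↭_; ↭-reflexive; ↭-sym; ↭-trans; ↭⇒↭ₛ)
open import Data.List.Relation.Binary.Permutation.Propositional.Properties
  using (∈-resp-↭; ++-comm; shifts)
import Data.List.Relation.Binary.Permutation.Setoid.Properties as SetoidPermutation
open import Data.List.Relation.Unary.All as All using ()
open import Data.List.Relation.Unary.Any using (here; there)
open import Data.List.Relation.Unary.Any.Properties using (singleton⁻)
open import Data.List.Relation.Unary.AllPairs using (_∷_)
open import Data.List.Relation.Unary.Unique.Propositional using (Unique)
open import Data.List.Relation.Unary.Unique.Propositional.Properties using (++⁺)
open import Data.Nat using (ℕ; zero; suc)
open import Data.Product using (∃; _×_; _,_; proj₁; proj₂)
open import Data.Sum using (inj₁; inj₂; [_,_])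
import Data.Sum as Sum
open import Function using (_∘_; id)
open import Relation.Nullary using (¬_; Dec; yes; no; contradiction)
open import Relation.Binary.PropositionalEquality
  using (_≡_; refl; sym; trans; cong; cong₂; subst; setoid; module ≡-Reasoning)

open ≡-Reasoning

x∈p─q⇒x∉q : ∀ {n} {p q : Subset n} {x} → x ∈ p ─ q → x ∉ q
x∈p─q⇒x∉q {p = _ ∷ p} {_ ∷ q} (there x∈p─q) (there x∈q) = x∈p─q⇒x∉q x∈p─q x∈q
x∈p─q⇒x∉q {p = _ ∷ p} {true ∷ q} () here

Empty-∩-∪ : ∀ {n} {p q r : Subset n} → Empty (p ∩ q) → Empty (p ∩ r) → Empty (p ∩ (q ∪ r))
Empty-∩-∪ {p = p} {q} {r} p∩q-empty p∩r-empty (v , v∈p∩[q∪r]) with x∈p∩q⁻ p (q ∪ r) v∈p∩[q∪r]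
... | v∈p , v∈q∪r with x∈p∪q⁻ q r v∈q∪r
...   | inj₁ v∈q = p∩q-empty (v , x∈p∩q⁺ (v∈p , v∈q))
...   | inj₂ v∈r = p∩r-empty (v , x∈p∩q⁺ (v∈p , v∈r))

Unique-++⇒Disjoint : ∀ {n} (xs : List (Fin n)) {ys} → Unique (xs ++ ys) → Disjoint xs ys
Unique-++⇒Disjoint (x ∷ xs) (x∉xs++ys ∷ _) (here refl , v∈ys) = All.lookup x∉xs++ys (∈-++⁺ʳ xs v∈ys) refl
Unique-++⇒Disjoint (x ∷ xs) (_ ∷ unique) (there v∈xs , v∈ys) = Unique-++⇒Disjoint xs unique (v∈xs , v∈ys)

Enumerates : ∀ {n} → Subset n → List (Fin n) → Set
Enumerates S W = Unique W × (∀ v → (v ∈ S → v ∈L W) × (v ∈L W → v ∈ S))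

Enumerates-resp-↭ : ∀ {n} {S : Subset n} {xs ys} → xs ↭ ys → Enumerates S xs → Enumerates S ys
Enumerates-resp-↭ xs↭ys (unique , enum) =
  SetoidPermutation.Unique-resp-↭ (setoid _) (↭⇒↭ₛ xs↭ys) unique ,
  λ v → ∈-resp-↭ xs↭ys ∘ proj₁ (enum v) , proj₂ (enum v) ∘ ∈-resp-↭ (↭-sym xs↭ys)

Enumerates-∪ : ∀ {n} {X Y : Subset n} {xs ys} →
  Empty (X ∩ Y) → Enumerates X xs → Enumerates Y ys → Enumerates (X ∪ Y) (xs ++ ys)
Enumerates-∪ {X = X} {Y} {xs} {ys} X∩Y-empty (unique-xs , enum-xs) (unique-ys , enum-ys) =
  ++⁺ unique-xs unique-ys disjoint ,
  λ v → [ ∈-++⁺ˡ ∘ proj₁ (enum-xs v) , ∈-++⁺ʳ xs ∘ proj₁ (enum-ys v) ] ∘ x∈p∪q⁻ X Y ,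
        x∈p∪q⁺ ∘ Sum.map (proj₂ (enum-xs v)) (proj₂ (enum-ys v)) ∘ ∈-++⁻ xs
  where
  disjoint : Disjoint xs ys
  disjoint {v} (v∈xs , v∈ys) = X∩Y-empty (v , x∈p∩q⁺ (proj₂ (enum-xs v) v∈xs , proj₂ (enum-ys v) v∈ys))

Enumerates-tail : ∀ {n} {X : Subset n} {x W} → x ∉ X → Enumerates (X ∪ ⁅ x ⁆) (x ∷ W) → Enumerates X W
Enumerates-tail {X = X} {x} {W} x∉X (x∉W ∷ unique , enum) = unique , λ v → into-W v , into-X v
  where
  into-W : ∀ v → v ∈ X → v ∈L W
  into-W v v∈X with proj₁ (enum v) (x∈p∪q⁺ (inj₁ v∈X))
  ... | here refl = contradiction v∈X x∉X
  ... | there v∈W = v∈W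
  into-X : ∀ v → v ∈L W → v ∈ X
  into-X v v∈W with x∈p∪q⁻ X ⁅ x ⁆ (proj₂ (enum v) (there v∈W))
  ... | inj₁ v∈X = v∈X
  ... | inj₂ v∈⁅x⁆ = contradiction (sym (x∈⁅y⁆⇒x≡y x v∈⁅x⁆)) (All.lookup x∉W v∈W)

AllSub-root : ∀ {n} {P : BTree n → Set} t → AllSub P t → P t
AllSub-root (leaf _)   p       = p
AllSub-root (node _ _) (p , _) = p

AllSub-map⊆ : ∀ {n} {P Q : BTree n → Set} t →
  (∀ s → leaves s ⊆L leaves t → P s → Q s) → AllSub P t → AllSub Q t
AllSub-map⊆ (leaf v)   f p            = f (leaf v) id p
AllSub-map⊆ (node l r) f (p , pl , pr) =
  f (node l r) id p ,
  AllSub-map⊆ l (λ s s⊆l → f s (∈-++⁺ˡ ∘ s⊆l)) pl ,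
  AllSub-map⊆ r (λ s s⊆r → f s (∈-++⁺ʳ (leaves l) ∘ s⊆r)) pr

module Rerooting {n : ℕ} (S : Subset n) (Good : List (Fin n) → Set)
  (Good-complement : ∀ xs ys → Enumerates S (xs ++ ys) → Good xs → Good ys) where

  AllGood : BTree n → Set
  AllGood = AllSub (Good ∘ leaves)

  -- t hangs below the rest o of the tree; rerooting at x ∈ leaves t turns o into a subtree.
  mutual
    reroot-below : ∀ {x} t o → x ∈L leaves t → Enumerates S (leaves t ++ leaves o) →
      AllGood t → AllGood o → ∃ λ R → Enumerates S (x ∷ leaves R) × AllGood R
    reroot-below (leaf _) o (here refl) enum _ good-o = o , enum , good-o
    reroot-below (node l r) o x∈t enum (_ , good-l , good-r) good-o with ∈-++⁻ (leaves l) x∈t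
    ... | inj₁ x∈l = descend l r o x∈l (Enumerates-resp-↭ reassociate enum) good-l good-r good-o
      where reassociate = ↭-reflexive (++-assoc (leaves l) (leaves r) (leaves o))
    ... | inj₂ x∈r = descend r l o x∈r (Enumerates-resp-↭ reassociate enum) good-r good-l good-o
      where reassociate = ↭-trans (↭-reflexive (++-assoc (leaves l) (leaves r) (leaves o)))
                                  (shifts (leaves l) (leaves r))

    descend : ∀ {x} c s o → x ∈L leaves c → Enumerates S (leaves c ++ leaves s ++ leaves o) →
      AllGood c → AllGood s → AllGood o → ∃ λ R → Enumerates S (x ∷ leaves R) × AllGood R
    descend c s o x∈c enum good-c good-s good-o =
      reroot-below c (node s o) x∈c enum good-c
        (Good-complement (leaves c) _ enum (AllSub-root c good-c) , good-s , good-o)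

  reroot : ∀ {x} l r → x ∈L leaves (node l r) → Enumerates S (leaves (node l r)) →
    AllGood l → AllGood r → ∃ λ R → Enumerates S (x ∷ leaves R) × AllGood R
  reroot l r x∈t enum good-l good-r with ∈-++⁻ (leaves l) x∈t
  ... | inj₁ x∈l = reroot-below l r x∈l enum good-l good-r
  ... | inj₂ x∈r = reroot-below r l x∈r (Enumerates-resp-↭ (++-comm (leaves l) (leaves r)) enum) good-r good-l

module _ {n : ℕ} (G : Graph n) where

  xsum-cong : ∀ m {f g : Fin m → Bool} → (∀ i → f i ≡ g i) → xsum G m f ≡ xsum G m g
  xsum-cong zero    f≗g = refl
  xsum-cong (suc m) f≗g = cong₂ _xor_ (f≗g zero) (xsum-cong m (f≗g ∘ suc))

  xsum-∧ʳ : ∀ m (f : Fin m → Bool) b → xsum G m f ∧ b ≡ xsum G m (λ i → f i ∧ b)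
  xsum-∧ʳ zero    f b = refl
  xsum-∧ʳ (suc m) f b =
    trans (∧-distribʳ-xor b (f zero) _) (cong ((f zero ∧ b) xor_) (xsum-∧ʳ m (f ∘ suc) b))

  CutRank≤-whole : ∀ {S X k} → (∀ v → v ∈ S → X v) → CutRank≤ G S X k
  CutRank≤-whole S⊆X =
    (λ _ _ → false) , (λ _ _ → false) , λ _ y _ y∈S y∉X → contradiction (S⊆X y y∈S) y∉X

  CutRank≤-complement : ∀ {S k} xs ys → Enumerates S (xs ++ ys) →
    CutRank≤ G S (_∈L xs) k → CutRank≤ G S (_∈L ys) k
  CutRank≤-complement {S} {k} xs ys (unique , enum) (P , Q , factor) =
    (λ v i → Q i v) , (λ i v → P v i) , factorᵀ
    where
    factorᵀ : ∀ u y → u ∈L ys → y ∈ S → ¬ y ∈L ys → adj G u y ≡ xsum G k (λ i → Q i u ∧ P y i)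
    factorᵀ u y u∈ys y∈S y∉ys with ∈-++⁻ xs (proj₁ (enum y) y∈S)
    ... | inj₂ y∈ys = contradiction y∈ys y∉ys
    ... | inj₁ y∈xs = begin
      adj G u y                        ≡⟨ symm G u y ⟩
      adj G y u                        ≡⟨ factor y u y∈xs u∈S u∉xs ⟩
      xsum G k (λ i → P y i ∧ Q i u)   ≡⟨ xsum-cong k (λ i → ∧-comm (P y i) (Q i u)) ⟩
      xsum G k (λ i → Q i u ∧ P y i)   ∎
      where
      u∈S = proj₂ (enum u) (∈-++⁺ʳ xs u∈ys)
      u∉xs = λ u∈xs → Unique-++⇒Disjoint xs unique (u∈xs , u∈ys)

  CrossEdgesFactor : Subset n → Fin n → Fin n → Set
  CrossEdgesFactor X x w = ∀ u y → u ∈ X → y ∉ X → adj G u y ≡ adj G u x ∧ adj G w y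

  splitModule-crossEdgesFactor : ∀ {X x} → SplitModule G X → Nbh G X x → ∃ (CrossEdgesFactor X x)
  splitModule-crossEdgesFactor (inj₁ refl) (x∉⊤ , _) = contradiction ∈⊤ x∉⊤
  splitModule-crossEdgesFactor (inj₂ (inj₁ refl)) (_ , _ , u∈⊥ , _) = contradiction u∈⊥ ∉⊥
  splitModule-crossEdgesFactor {X} {x} (inj₂ (inj₂ (V , (_ , _ , closed) , X⊆V , (_ , _ , split))))
                               x∈N[X]@(x∉X , w , w∈X , wx) = w , factor
    where
    frontier : ∀ {u y} → u ∈ X → adj G u y ≡ true → y ∉ X → Nbh G (V ─ X) u
    frontier {u} {y} u∈X uy y∉X =
      (λ u∈V─X → x∈p─q⇒x∉q u∈V─X u∈X) ,
      y , x∈p∧x∉q⇒x∈p─q (closed u y (X⊆V u∈X) uy) y∉X , trans (symm G y u) uy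

    w∈N[V─X] : Nbh G (V ─ X) w
    w∈N[V─X] = frontier w∈X wx x∉X

    factor : CrossEdgesFactor X x w
    factor v y v∈X y∉X with adj G v y in vy
    ... | true = sym (cong₂ _∧_ (trans (split v w x v∈N[V─X] w∈N[V─X] x∈N[X]) wx)
                                (trans (sym (split v w y v∈N[V─X] w∈N[V─X] (y∉X , v , v∈X , vy))) vy))
      where v∈N[V─X] = frontier v∈X vy y∉X
    ... | false with adj G v x in vx
    ...   | false = refl
    ...   | true with adj G w y in wy
    ...     | false = refl
    ...     | true  = contradiction
                        (trans (trans (sym vy) (split v w y (frontier v∈X vx x∉X) w∈N[V─X] (y∉X , w , w∈X , wy))) wy)
                        λ ()

  CutRank≤-lift : ∀ {X x w k} {L : Fin n → Set} → x ∉ X → CrossEdgesFactor X x w →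
    (∀ v → L v → v ∈ X) → CutRank≤ G (X ∪ ⁅ x ⁆) L k → CutRank≤ G ⊤ L k
  CutRank≤-lift {X} {x} {w} {k} {L} x∉X cross L⊆X (P , Q , factor) =
    P , (λ i y → column y (y ∈? X) i) , λ u y u∈L _ y∉L → factor′ u y (y ∈? X) u∈L y∉L
    where
    column : ∀ y → Dec (y ∈ X) → Fin k → Bool
    column y (yes _) i = Q i y
    column y (no _)  i = Q i x ∧ adj G w y

    factor′ : ∀ u y (y∈?X : Dec (y ∈ X)) → L u → ¬ L y →
      adj G u y ≡ xsum G k (λ i → P u i ∧ column y y∈?X i)
    factor′ u y (yes y∈X) u∈L y∉L = factor u y u∈L (x∈p∪q⁺ (inj₁ y∈X)) y∉L
    factor′ u y (no y∉X)  u∈L y∉L = begin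
      adj G u y                                     ≡⟨ cross u y (L⊆X u u∈L) y∉X ⟩
      adj G u x ∧ adj G w y                         ≡⟨ cong (_∧ adj G w y) (factor u x u∈L x∈S (x∉X ∘ L⊆X x)) ⟩
      xsum G k (λ i → P u i ∧ Q i x) ∧ adj G w y     ≡⟨ xsum-∧ʳ k _ (adj G w y) ⟩
      xsum G k (λ i → (P u i ∧ Q i x) ∧ adj G w y)   ≡⟨ xsum-cong k (λ i → ∧-assoc (P u i) (Q i x) (adj G w y)) ⟩
      xsum G k (λ i → P u i ∧ (Q i x ∧ adj G w y))   ∎
      where x∈S = x∈p∪q⁺ (inj₂ (x∈⁅x⁆ x))

  Decomposition : ℕ → Subset n → BTree n → Set
  Decomposition k X t = Enumerates X (leaves t) × AllSub (λ s → CutRank≤ G ⊤ (_∈L leaves s) k) t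

  splitModule-decomposition : ∀ {k X x} → SplitModule G X → Nbh G X x → RW≤ G (X ∪ ⁅ x ⁆) k →
    ∃ (Decomposition k X)
  splitModule-decomposition {k} {X} {x} module-X x∈N[X]@(x∉X , u , u∈X , _) = from
    where
    S = X ∪ ⁅ x ⁆
    x∈S : x ∈ S
    x∈S = x∈p∪q⁺ (inj₂ (x∈⁅x⁆ x))
    u∈S : u ∈ S
    u∈S = x∈p∪q⁺ (inj₁ u∈X)

    open Rerooting S (λ W → CutRank≤ G S (_∈L W) k) CutRank≤-complement

    lift : ∀ {W} → Enumerates X W → ∀ s → leaves s ⊆L W →
      CutRank≤ G S (_∈L leaves s) k → CutRank≤ G ⊤ (_∈L leaves s) k
    lift (_ , enum) s s⊆W = CutRank≤-lift x∉X cross (λ v → proj₂ (enum v) ∘ s⊆W)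
      where cross = proj₂ (splitModule-crossEdgesFactor module-X x∈N[X])

    from : RW≤ G S k → ∃ (Decomposition k X)
    from (inj₁ S-empty) = contradiction x∈S (S-empty x)
    from (inj₂ (leaf _ , (_ , enum) , _)) = contradiction (subst (_∈ X) u≡x u∈X) x∉X
      where u≡x = trans (singleton⁻ (proj₁ (enum u) u∈S)) (sym (singleton⁻ (proj₁ (enum x) x∈S)))
    from (inj₂ (node l r , enum , (_ , good-l , good-r)))
      with reroot l r (proj₁ (proj₂ enum x) x∈S) enum good-l good-r
    ... | R , enum-R , good-R = R , enum-X , AllSub-map⊆ R (lift enum-X) good-R
      where enum-X = Enumerates-tail x∉X enum-R

lemma4 : (k n : ℕ) (G : Graph n) (A B C : Subset n) →
    SplitModule G A → SplitModule G B → SplitModule G C →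
    Empty (A ∩ B) → Empty (A ∩ C) → Empty (B ∩ C) →
    A ∪ B ∪ C ≡ ⊤ →
    ∀ a b c → Nbh G A a → Nbh G B b → Nbh G C c →
    RW≤ G (A ∪ ⁅ a ⁆) k → RW≤ G (B ∪ ⁅ b ⁆) k → RW≤ G (C ∪ ⁅ c ⁆) k →
    RW≤ G ⊤ k
lemma4 _ _ G _ _ _ module-A module-B module-C A∩B-empty A∩C-empty B∩C-empty A∪B∪C≡⊤
       _ _ _ a∈N[A] b∈N[B] c∈N[C] rw-A rw-B rw-C
  with splitModule-decomposition G module-A a∈N[A] rw-A
     | splitModule-decomposition G module-B b∈N[B] rw-B
     | splitModule-decomposition G module-C c∈N[C] rw-C
... | tA , enum-A , good-A | tB , enum-B , good-B | tC , enum-C , good-C =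
  inj₂ (node tA (node tB tC) , enum ,
        CutRank≤-whole G (λ v _ → proj₁ (proj₂ enum v) ∈⊤) ,
        good-A ,
        (CutRank≤-complement G (leaves tA) _ enum (AllSub-root tA good-A) , good-B , good-C))
  where
  enum : Enumerates ⊤ (leaves tA ++ leaves tB ++ leaves tC)
  enum = subst (λ S → Enumerates S _) A∪B∪C≡⊤
           (Enumerates-∪ (Empty-∩-∪ A∩B-empty A∩C-empty) enum-A (Enumerates-∪ B∩C-empty enum-B enum-C))
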